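{- Let $q$ be a power of an odd prime and let $G$ be a connected labeled graph over $\mathbf{F}_q$ on $\{1,\dots,n\}$ with $n\ge3$. Then for every $\phi\in\Lambda(G,G)$ the vector $\det\phi$ is constant, i.e. $\det\phi=\alpha I$ for some $\alpha\in\mathbf{F}_q$.
   Context: A labeled graph is a symmetric matrix $G=(g_{ij})$ over $\mathbf{F}_q$ with zero diagonal; $ij$ is an edge iff $g_{ij}\ne0$ and connectivity refers to this simple graph. Neighborhood function $g(i)=(g_{i1},\dots,g_{in})$; $e_i$ standard basis vectors; $I$ the all-ones vector; $\times$ coordinatewise product; $\langle u,v\rangle=\sum_ku_kv_k$. $\Lambda(G,G)$ is the set of $(X,Y,Z,T)\in(\mathbf{F}_q^n)^4$ with $\langle X,g(i)\times g(j)\rangle-\langle Y,g(i)\times e_j\rangle+\langle Z,e_i\times g(j)\rangle-\langle T,e_i\times e_j\rangle=0$ for all vertices $i,j$. For $\phi=(X,Y,Z,T)$, $\det\phi=Y\times Z-X\times T$. -}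

module Defs where

open import Level using (0ℓ)
open import Data.Nat using (ℕ; zero; suc; _^_; _≥_; _%_)
open import Data.Nat.Primality using (Prime)
open import Data.Fin using (Fin; _≟_)
import Data.Fin as F
open import Data.Product using (Σ; ∃; _×_; _,_)
open import Relation.Nullary using (¬_; yes; no)
open import Relation.Binary.PropositionalEquality using (_≡_)
import Relation.Binary.PropositionalEquality as ≡
open import Relation.Binary.Construct.Closure.ReflexiveTransitive using (Star)
open import Algebra.Bundles using (CommutativeRing)
open import Function.Bundles using (Bijection)

record FiniteField : Set₁ where
  field
    commRing : CommutativeRing 0ℓ 0ℓ
  open CommutativeRing commRing public
  field
    0≉1     : ¬ (0# ≈ 1#)
    inverse : ∀ x → ¬ (x ≈ 0#) → ∃ λ y → x * y ≈ 1#
    order   : ℕ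
    enum    : Bijection setoid (≡.setoid (Fin order))

IsOddPrimePower : ℕ → Set
IsOddPrimePower q = Σ ℕ λ p → Σ ℕ λ k → Prime p × (p % 2 ≡ 1) × (k ≥ 1) × (q ≡ p ^ k)

module _ (𝔽 : FiniteField) where
  open FiniteField 𝔽

  Vec : ℕ → Set
  Vec n = Fin n → Carrier

  ∑ : ∀ {n} → Vec n → Carrier
  ∑ {zero}  v = 0#
  ∑ {suc n} v = v F.zero + ∑ {n} (λ k → v (F.suc k))

  ⟨_,_⟩ : ∀ {n} → Vec n → Vec n → Carrier
  ⟨ u , v ⟩ = ∑ (λ k → u k * v k)

  _⊗_ : ∀ {n} → Vec n → Vec n → Vec n
  (u ⊗ v) k = u k * v k

  e : ∀ {n} → Fin n → Vec n
  e i k with i ≟ k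
  ... | yes _ = 1#
  ... | no  _ = 0#

  I : ∀ {n} → Vec n
  I k = 1#

  _·_ : ∀ {n} → Carrier → Vec n → Vec n
  (a · v) k = a * v k

  _≋_ : ∀ {n} → Vec n → Vec n → Set
  u ≋ v = ∀ k → u k ≈ v k

  record LabeledGraph (n : ℕ) : Set where
    field
      mat  : Fin n → Fin n → Carrier
      sym  : ∀ i j → mat i j ≈ mat j i
      diag : ∀ i → mat i i ≈ 0#

  module _ {n : ℕ} (G : LabeledGraph n) where
    open LabeledGraph G

    g : Fin n → Vec n
    g i j = mat i j

    Edge : Fin n → Fin n → Set
    Edge i j = ¬ (mat i j ≈ 0#)

    Connected : Set
    Connected = ∀ i j → Star Edge i j

    InΛ : Vec n × Vec n × Vec n × Vec n → Set
    InΛ (X , Y , Z , T) = ∀ i j →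
      ((⟨ X , g i ⊗ g j ⟩ - ⟨ Y , g i ⊗ e j ⟩) + ⟨ Z , e i ⊗ g j ⟩) - ⟨ T , e i ⊗ e j ⟩ ≈ 0#

  det : ∀ {n} → Vec n × Vec n × Vec n × Vec n → Vec n
  det (X , Y , Z , T) k = Y k * Z k - X k * T k

{-# OPTIONS --safe #-}
-- Read X, Y, Z, T as diagonal matrices, G as the symmetric matrix (g_ij), and put GXG = G·X·G.
-- Entrywise, φ ∈ Λ(G,G) says GXG + Z·G = G·Y + T. Multiplying it on the left by G·X gives
-- G·X·GXG + G·X·Z·G = GXG·Y + G·X·T; multiplying its transpose GXG + G·Z = Y·G + T on the right
-- by X·G gives GXG·X·G + G·Z·X·G = Y·GXG + T·X·G. The left-hand sides agree by associativity and
-- because diagonal matrices commute, so GXG·Y + G·X·T = Y·GXG + T·X·G. On an edge ij (so i ≠ j and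
-- g_ij ≠ 0) the (i,j) entry of this identity and the (i,j) and (j,i) entries of the Λ-condition
-- combine to g_ij·(det_i − det_j) = 0. Connectivity propagates det_i = det_j along walks.
module Submission where

open import Defs
open import Data.Nat using (ℕ; _≥_; suc)
open import Data.Fin using (Fin; zero; _≟_)
open import Data.Fin.Properties using (punchInᵢ≢i)
open import Data.Product using (∃; _×_; _,_)
open import Data.Vec.Functional using (Vector; replicate; removeAt; tail)
open import Function using (_∘_)
open import Relation.Nullary using (¬_; yes; no; contradiction)
open import Relation.Binary.PropositionalEquality using (_≢_; ≢-sym)
import Relation.Binary.PropositionalEquality as ≡
open import Relation.Binary.Construct.Closure.ReflexiveTransitive using (Star; fold)
open import Algebra.Bundles using (CommutativeRing)
open import Algebra.Definitions using (AlmostLeftCancellative)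

module CommutativeRingProperties {c ℓ} (R : CommutativeRing c ℓ) where
  open CommutativeRing R
  open import Algebra.Properties.Group +-group using () renaming (∙-cancelʳ to +-cancelʳ)
  open import Algebra.Properties.AbelianGroup +-abelianGroup using (xyx⁻¹≈y)
  open import Algebra.Properties.Semiring.Sum semiring
    using (sum; sum-cong-≋; sum-remove; sum-replicate-zero; ∑-comm; *-distribˡ-sum; *-distribʳ-sum)
  -- The solver is for commutative semirings: negated terms enter it as atoms.
  open import Algebra.Solver.Ring.NaturalCoefficients.Default commutativeSemiring
  open import Relation.Binary.Reasoning.Setoid setoid

  x-y+z≈w⇒x+z≈y+w : ∀ {x y z w} → (x - y) + z ≈ w → x + z ≈ y + w
  x-y+z≈w⇒x+z≈y+w {x} {y} {z} {w} x-y+z≈w = +-cancelʳ (- y) _ _ (begin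
    (x + z) - y ≈⟨ solve 3 (λ x -y z → (x :+ z) :+ -y := (x :+ -y) :+ z) refl x (- y) z ⟩
    (x - y) + z ≈⟨ x-y+z≈w ⟩
    w           ≈⟨ xyx⁻¹≈y y w ⟨
    (y + w) - y ∎)

  x-y+[y+z]≈x+z : ∀ x y z → (x - y) + (y + z) ≈ x + z
  x-y+[y+z]≈x+z x y z = begin
    (x - y) + (y + z)
      ≈⟨ solve 4 (λ x y -y z → (x :+ -y) :+ (y :+ z) := (x :+ z) :+ (y :+ -y)) refl x y (- y) z ⟩
    (x + z) + (y - y) ≈⟨ +-congˡ (-‿inverseʳ y) ⟩
    (x + z) + 0#      ≈⟨ +-identityʳ _ ⟩
    x + z             ∎

  x+w≈z+y⇒x-y≈z-w : ∀ {x y z w} → x + w ≈ z + y → x - y ≈ z - w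
  x+w≈z+y⇒x-y≈z-w {x} {y} {z} {w} x+w≈z+y = +-cancelʳ (y + w) _ _ (begin
    (x - y) + (y + w) ≈⟨ x-y+[y+z]≈x+z x y w ⟩
    x + w             ≈⟨ x+w≈z+y ⟩
    z + y             ≈⟨ x-y+[y+z]≈x+z z w y ⟨
    (z - w) + (w + y) ≈⟨ +-congˡ (+-comm w y) ⟩
    (z - w) + (y + w) ∎)

  sum-supported : ∀ {n} (f : Vector Carrier n) i → (∀ k → k ≢ i → f k ≈ 0#) → sum f ≈ f i
  sum-supported {suc n} f i f≈0 = begin
    sum f                      ≈⟨ sum-remove f ⟩
    f i + sum (removeAt f i)   ≈⟨ +-congˡ (sum-cong-≋ (λ k → f≈0 _ (punchInᵢ≢i i k))) ⟩
    f i + sum (replicate n 0#) ≈⟨ +-congˡ (sum-replicate-zero n) ⟩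
    f i + 0#                   ≈⟨ +-identityʳ _ ⟩
    f i                        ∎

  ∑-assoc : ∀ {n} (a : Vector Carrier n) (B : Fin n → Fin n → Carrier) (c : Vector Carrier n) →
    sum (λ l → a l * sum (λ k → B l k * c k)) ≈ sum (λ k → sum (λ l → a l * B l k) * c k)
  ∑-assoc a B c = begin
    sum (λ l → a l * sum (λ k → B l k * c k))
      ≈⟨ sum-cong-≋ (λ l → *-distribˡ-sum (a l) (λ k → B l k * c k)) ⟩
    sum (λ l → sum (λ k → a l * (B l k * c k)))
      ≈⟨ ∑-comm (λ l k → a l * (B l k * c k)) ⟩
    sum (λ k → sum (λ l → a l * (B l k * c k)))
      ≈⟨ sum-cong-≋ (λ k → sum-cong-≋ (λ l → *-assoc (a l) (B l k) (c k))) ⟨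
    sum (λ k → sum (λ l → (a l * B l k) * c k))
      ≈⟨ sum-cong-≋ (λ k → *-distribʳ-sum (c k) (λ l → a l * B l k)) ⟨
    sum (λ k → sum (λ l → a l * B l k) * c k)
      ∎

module _ (𝔽 : FiniteField) where
  open FiniteField 𝔽
  open CommutativeRingProperties commRing
  open import Algebra.Properties.Group +-group using (x∙y⁻¹≈ε⇒x≈y) renaming (∙-cancelʳ to +-cancelʳ)
  open import Algebra.Properties.Semiring.Sum semiring
    using (sum; sum-cong-≋; ∑-distrib-+; *-distribˡ-sum)
  open import Algebra.Properties.CommutativeSemigroup *-commutativeSemigroup
    using (x∙yz≈y∙xz; x∙yz≈yx∙z; xy∙z≈xz∙y)
  open import Algebra.Solver.Ring.NaturalCoefficients.Default commutativeSemiring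
  open import Relation.Binary.Reasoning.Setoid setoid

  *-almostCancelˡ : AlmostLeftCancellative _≈_ 0# _*_
  *-almostCancelˡ a x y a≉0 ax≈ay with inverse a a≉0
  ... | b , ab≈1 = begin
    x           ≈⟨ b*[a*z]≈z x ⟨
    b * (a * x) ≈⟨ *-congˡ ax≈ay ⟩
    b * (a * y) ≈⟨ b*[a*z]≈z y ⟩
    y           ∎
    where
    b*[a*z]≈z : ∀ z → b * (a * z) ≈ z
    b*[a*z]≈z z = begin
      b * (a * z) ≈⟨ x∙yz≈yx∙z b a z ⟩
      (a * b) * z ≈⟨ *-congʳ ab≈1 ⟩
      1# * z      ≈⟨ *-identityˡ z ⟩
      z           ∎

  edge-equations⇒det≈det : ∀ {a N xᵢ yᵢ zᵢ tᵢ xⱼ yⱼ zⱼ tⱼ} → ¬ a ≈ 0# →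
    N + zᵢ * a ≈ yⱼ * a → N + zⱼ * a ≈ yᵢ * a →
    yⱼ * N + tⱼ * (xⱼ * a) ≈ yᵢ * N + tᵢ * (xᵢ * a) →
    yᵢ * zᵢ - xᵢ * tᵢ ≈ yⱼ * zⱼ - xⱼ * tⱼ
  edge-equations⇒det≈det {a} {N} {xᵢ} {yᵢ} {zᵢ} {tᵢ} {xⱼ} {yⱼ} {zⱼ} {tⱼ}
                         a≉0 eqᵢⱼ eqⱼᵢ eq-weighted =
    x+w≈z+y⇒x-y≈z-w (*-almostCancelˡ a _ _ a≉0 (+-cancelʳ (yᵢ * N + yⱼ * N) _ _ (begin
      a * (yᵢ * zᵢ + xⱼ * tⱼ) + (yᵢ * N + yⱼ * N)
        ≈⟨ solve 7 (λ a N yᵢ zᵢ xⱼ tⱼ yⱼ →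
             a :* (yᵢ :* zᵢ :+ xⱼ :* tⱼ) :+ (yᵢ :* N :+ yⱼ :* N)
             := (yᵢ :* N :+ yᵢ :* (zᵢ :* a)) :+ (yⱼ :* N :+ tⱼ :* (xⱼ :* a)))
             refl a N yᵢ zᵢ xⱼ tⱼ yⱼ ⟩
      (yᵢ * N + yᵢ * (zᵢ * a)) + (yⱼ * N + tⱼ * (xⱼ * a))
        ≈⟨ +-cong both-≈-yᵢyⱼa eq-weighted ⟩
      (yⱼ * N + yⱼ * (zⱼ * a)) + (yᵢ * N + tᵢ * (xᵢ * a))
        ≈⟨ solve 7 (λ a N yᵢ zⱼ xᵢ tᵢ yⱼ →
             (yⱼ :* N :+ yⱼ :* (zⱼ :* a)) :+ (yᵢ :* N :+ tᵢ :* (xᵢ :* a))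
             := a :* (yⱼ :* zⱼ :+ xᵢ :* tᵢ) :+ (yᵢ :* N :+ yⱼ :* N))
             refl a N yᵢ zⱼ xᵢ tᵢ yⱼ ⟩
      a * (yⱼ * zⱼ + xᵢ * tᵢ) + (yᵢ * N + yⱼ * N) ∎)))
    where
    both-≈-yᵢyⱼa : yᵢ * N + yᵢ * (zᵢ * a) ≈ yⱼ * N + yⱼ * (zⱼ * a)
    both-≈-yᵢyⱼa = begin
      yᵢ * N + yᵢ * (zᵢ * a) ≈⟨ distribˡ yᵢ N (zᵢ * a) ⟨
      yᵢ * (N + zᵢ * a)      ≈⟨ *-congˡ eqᵢⱼ ⟩
      yᵢ * (yⱼ * a)          ≈⟨ x∙yz≈y∙xz yᵢ yⱼ a ⟩
      yⱼ * (yᵢ * a)          ≈⟨ *-congˡ eqⱼᵢ ⟨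
      yⱼ * (N + zⱼ * a)      ≈⟨ distribˡ yⱼ N (zⱼ * a) ⟩
      yⱼ * N + yⱼ * (zⱼ * a) ∎

  ∑≈sum : ∀ {n} (v : Vec 𝔽 n) → ∑ 𝔽 v ≈ sum v
  ∑≈sum {ℕ.zero} v = refl
  ∑≈sum {suc n}  v = +-congˡ (∑≈sum (tail v))

  e-diagonal : ∀ {n} (i : Fin n) → e 𝔽 i i ≈ 1#
  e-diagonal i with i ≟ i
  ... | yes _  = refl
  ... | no i≢i = contradiction ≡.refl i≢i

  e-off-diagonal : ∀ {n} {i k : Fin n} → k ≢ i → e 𝔽 i k ≈ 0#
  e-off-diagonal {i = i} {k} k≢i with i ≟ k
  ... | yes i≡k = contradiction (≡.sym i≡k) k≢i
  ... | no _    = refl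

  sum-*-e : ∀ {n} (f : Vec 𝔽 n) i → sum (λ k → f k * e 𝔽 i k) ≈ f i
  sum-*-e f i = begin
    sum (λ k → f k * e 𝔽 i k)
      ≈⟨ sum-supported _ i (λ k k≢i → trans (*-congˡ (e-off-diagonal k≢i)) (zeroʳ (f k))) ⟩
    f i * e 𝔽 i i             ≈⟨ *-congˡ (e-diagonal i) ⟩
    f i * 1#                  ≈⟨ *-identityʳ _ ⟩
    f i                       ∎

  ⟨u,v⊗eⱼ⟩≈uⱼvⱼ : ∀ {n} (u v : Vec 𝔽 n) j → ∑ 𝔽 (λ k → u k * (v k * e 𝔽 j k)) ≈ u j * v j
  ⟨u,v⊗eⱼ⟩≈uⱼvⱼ u v j = begin
    ∑ 𝔽 (λ k → u k * (v k * e 𝔽 j k)) ≈⟨ ∑≈sum (λ k → u k * (v k * e 𝔽 j k)) ⟩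
    sum (λ k → u k * (v k * e 𝔽 j k)) ≈⟨ sum-cong-≋ (λ k → *-assoc (u k) (v k) (e 𝔽 j k)) ⟨
    sum (λ k → (u k * v k) * e 𝔽 j k) ≈⟨ sum-*-e (λ k → u k * v k) j ⟩
    u j * v j                         ∎

  ⟨u,eᵢ⊗v⟩≈uᵢvᵢ : ∀ {n} (u v : Vec 𝔽 n) i → ∑ 𝔽 (λ k → u k * (e 𝔽 i k * v k)) ≈ u i * v i
  ⟨u,eᵢ⊗v⟩≈uᵢvᵢ u v i = begin
    ∑ 𝔽 (λ k → u k * (e 𝔽 i k * v k)) ≈⟨ ∑≈sum (λ k → u k * (e 𝔽 i k * v k)) ⟩
    sum (λ k → u k * (e 𝔽 i k * v k)) ≈⟨ sum-cong-≋ (λ k → *-congˡ (*-comm (e 𝔽 i k) (v k))) ⟩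
    sum (λ k → u k * (v k * e 𝔽 i k)) ≈⟨ sum-cong-≋ (λ k → *-assoc (u k) (v k) (e 𝔽 i k)) ⟨
    sum (λ k → (u k * v k) * e 𝔽 i k) ≈⟨ sum-*-e (λ k → u k * v k) i ⟩
    u i * v i                         ∎

  module _ {n} (G : LabeledGraph 𝔽 n) (X Y Z T : Vec 𝔽 n) (φ∈Λ : InΛ 𝔽 G (X , Y , Z , T)) where
    open LabeledGraph G using (mat) renaming (sym to mat-sym; diag to mat-diag)

    GXG : Fin n → Fin n → Carrier
    GXG i j = sum (λ k → X k * (mat i k * mat j k))

    GXG-sym : ∀ i j → GXG i j ≈ GXG j i
    GXG-sym i j = sum-cong-≋ (λ k → *-congˡ (*-comm (mat i k) (mat j k)))

    GXG-expand : ∀ i j → GXG i j ≈ sum (λ k → mat i k * (X k * mat k j))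
    GXG-expand i j = sum-cong-≋ (λ k → begin
      X k * (mat i k * mat j k) ≈⟨ *-congˡ (*-congˡ (mat-sym j k)) ⟩
      X k * (mat i k * mat k j) ≈⟨ x∙yz≈y∙xz (X k) (mat i k) (mat k j) ⟩
      mat i k * (X k * mat k j) ∎)

    Λ-entry : ∀ i j → GXG i j + Z i * mat i j ≈ Y j * mat i j + T i * e 𝔽 j i
    Λ-entry i j = begin
      GXG i j + Z i * mat i j
        ≈⟨ +-cong (∑≈sum (λ k → X k * (mat i k * mat j k)))
                  (trans (⟨u,eᵢ⊗v⟩≈uᵢvᵢ Z (mat j) i) (*-congˡ (mat-sym j i))) ⟨
      ∑ 𝔽 (λ k → X k * (mat i k * mat j k)) + ∑ 𝔽 (λ k → Z k * (e 𝔽 i k * mat j k))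
        ≈⟨ x-y+z≈w⇒x+z≈y+w (x∙y⁻¹≈ε⇒x≈y _ _ (φ∈Λ i j)) ⟩
      ∑ 𝔽 (λ k → Y k * (mat i k * e 𝔽 j k)) + ∑ 𝔽 (λ k → T k * (e 𝔽 i k * e 𝔽 j k))
        ≈⟨ +-cong (⟨u,v⊗eⱼ⟩≈uⱼvⱼ Y (mat i) j) (⟨u,eᵢ⊗v⟩≈uᵢvᵢ T (e 𝔽 j) i) ⟩
      Y j * mat i j + T i * e 𝔽 j i
        ∎

    Λ-off-diagonal : ∀ {i j} → i ≢ j → GXG i j + Z i * mat i j ≈ Y j * mat i j
    Λ-off-diagonal {i} {j} i≢j = begin
      GXG i j + Z i * mat i j       ≈⟨ Λ-entry i j ⟩
      Y j * mat i j + T i * e 𝔽 j i ≈⟨ +-congˡ (trans (*-congˡ (e-off-diagonal i≢j)) (zeroʳ (T i))) ⟩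
      Y j * mat i j + 0#            ≈⟨ +-identityʳ _ ⟩
      Y j * mat i j                 ∎

    GX[GXG+ZG]≈GXGY+GXT : ∀ i j →
      sum (λ l → (mat i l * X l) * (GXG l j + Z l * mat l j)) ≈ Y j * GXG i j + T j * (X j * mat i j)
    GX[GXG+ZG]≈GXGY+GXT i j = begin
      sum (λ l → (mat i l * X l) * (GXG l j + Z l * mat l j))
        ≈⟨ sum-cong-≋ (λ l → *-congˡ (Λ-entry l j)) ⟩
      sum (λ l → (mat i l * X l) * (Y j * mat l j + T l * e 𝔽 j l))
        ≈⟨ sum-cong-≋ (λ l → distribˡ (mat i l * X l) _ _) ⟩
      sum (λ l → (mat i l * X l) * (Y j * mat l j) + (mat i l * X l) * (T l * e 𝔽 j l))
        ≈⟨ ∑-distrib-+ (λ l → (mat i l * X l) * (Y j * mat l j))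
                       (λ l → (mat i l * X l) * (T l * e 𝔽 j l)) ⟩
      sum (λ l → (mat i l * X l) * (Y j * mat l j)) + sum (λ l → (mat i l * X l) * (T l * e 𝔽 j l))
        ≈⟨ +-cong GXGY GXT ⟩
      Y j * GXG i j + T j * (X j * mat i j)
        ∎
      where
      GXGY : sum (λ l → (mat i l * X l) * (Y j * mat l j)) ≈ Y j * GXG i j
      GXGY = begin
        sum (λ l → (mat i l * X l) * (Y j * mat l j))
          ≈⟨ sum-cong-≋ (λ l → solve 4 (λ g x y h → (g :* x) :* (y :* h) := y :* (g :* (x :* h)))
                                   refl (mat i l) (X l) (Y j) (mat l j)) ⟩
        sum (λ l → Y j * (mat i l * (X l * mat l j)))
          ≈⟨ *-distribˡ-sum (Y j) (λ l → mat i l * (X l * mat l j)) ⟨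
        Y j * sum (λ l → mat i l * (X l * mat l j))
          ≈⟨ *-congˡ (GXG-expand i j) ⟨
        Y j * GXG i j
          ∎
      GXT : sum (λ l → (mat i l * X l) * (T l * e 𝔽 j l)) ≈ T j * (X j * mat i j)
      GXT = begin
        sum (λ l → (mat i l * X l) * (T l * e 𝔽 j l))
          ≈⟨ sum-cong-≋ (λ l → solve 4 (λ g x t δ → (g :* x) :* (t :* δ) := (t :* (x :* g)) :* δ)
                                   refl (mat i l) (X l) (T l) (e 𝔽 j l)) ⟩
        sum (λ l → (T l * (X l * mat i l)) * e 𝔽 j l) ≈⟨ sum-*-e (λ l → T l * (X l * mat i l)) j ⟩
        T j * (X j * mat i j)                         ∎

    [GXG+GZ]XG≈YGXG+TXG : ∀ i j →
      sum (λ l → (GXG i l + Z l * mat i l) * (X l * mat l j)) ≈ Y i * GXG i j + T i * (X i * mat i j)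
    [GXG+GZ]XG≈YGXG+TXG i j = begin
      sum (λ l → (GXG i l + Z l * mat i l) * (X l * mat l j))
        ≈⟨ sum-cong-≋ (λ l → *-congʳ (trans (+-cong (GXG-sym i l) (*-congˡ (mat-sym i l))) (Λ-entry l i))) ⟩
      sum (λ l → (Y i * mat l i + T l * e 𝔽 i l) * (X l * mat l j))
        ≈⟨ sum-cong-≋ (λ l → distribʳ (X l * mat l j) _ _) ⟩
      sum (λ l → (Y i * mat l i) * (X l * mat l j) + (T l * e 𝔽 i l) * (X l * mat l j))
        ≈⟨ ∑-distrib-+ (λ l → (Y i * mat l i) * (X l * mat l j))
                       (λ l → (T l * e 𝔽 i l) * (X l * mat l j)) ⟩
      sum (λ l → (Y i * mat l i) * (X l * mat l j)) + sum (λ l → (T l * e 𝔽 i l) * (X l * mat l j))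
        ≈⟨ +-cong YGXG TXG ⟩
      Y i * GXG i j + T i * (X i * mat i j)
        ∎
      where
      YGXG : sum (λ l → (Y i * mat l i) * (X l * mat l j)) ≈ Y i * GXG i j
      YGXG = begin
        sum (λ l → (Y i * mat l i) * (X l * mat l j))
          ≈⟨ sum-cong-≋ (λ l → trans (*-assoc (Y i) (mat l i) _) (*-congˡ (*-congʳ (mat-sym l i)))) ⟩
        sum (λ l → Y i * (mat i l * (X l * mat l j)))
          ≈⟨ *-distribˡ-sum (Y i) (λ l → mat i l * (X l * mat l j)) ⟨
        Y i * sum (λ l → mat i l * (X l * mat l j))
          ≈⟨ *-congˡ (GXG-expand i j) ⟨
        Y i * GXG i j
          ∎
      TXG : sum (λ l → (T l * e 𝔽 i l) * (X l * mat l j)) ≈ T i * (X i * mat i j)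
      TXG = begin
        sum (λ l → (T l * e 𝔽 i l) * (X l * mat l j))
          ≈⟨ sum-cong-≋ (λ l → xy∙z≈xz∙y (T l) (e 𝔽 i l) (X l * mat l j)) ⟩
        sum (λ l → (T l * (X l * mat l j)) * e 𝔽 i l) ≈⟨ sum-*-e (λ l → T l * (X l * mat l j)) i ⟩
        T i * (X i * mat i j)                         ∎

    GX[GXG]≈[GXG]XG : ∀ i j → sum (λ l → (mat i l * X l) * GXG l j) ≈ sum (λ l → GXG i l * (X l * mat l j))
    GX[GXG]≈[GXG]XG i j = begin
      sum (λ l → (mat i l * X l) * GXG l j)
        ≈⟨ sum-cong-≋ (λ l → *-congˡ (GXG-expand l j)) ⟩
      sum (λ l → (mat i l * X l) * sum (λ k → mat l k * (X k * mat k j)))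
        ≈⟨ ∑-assoc (λ l → mat i l * X l) mat (λ k → X k * mat k j) ⟩
      sum (λ k → sum (λ l → (mat i l * X l) * mat l k) * (X k * mat k j))
        ≈⟨ sum-cong-≋ (λ k → *-congʳ (trans (GXG-expand i k)
                                               (sum-cong-≋ (λ l → sym (*-assoc (mat i l) (X l) (mat l k)))))) ⟨
      sum (λ k → GXG i k * (X k * mat k j))
        ∎

    GX[GXG+ZG]≈[GXG+GZ]XG : ∀ i j →
      sum (λ l → (mat i l * X l) * (GXG l j + Z l * mat l j)) ≈
      sum (λ l → (GXG i l + Z l * mat i l) * (X l * mat l j))
    GX[GXG+ZG]≈[GXG+GZ]XG i j = begin
      sum (λ l → (mat i l * X l) * (GXG l j + Z l * mat l j))
        ≈⟨ sum-cong-≋ (λ l → distribˡ (mat i l * X l) _ _) ⟩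
      sum (λ l → (mat i l * X l) * GXG l j + (mat i l * X l) * (Z l * mat l j))
        ≈⟨ ∑-distrib-+ (λ l → (mat i l * X l) * GXG l j)
                       (λ l → (mat i l * X l) * (Z l * mat l j)) ⟩
      sum (λ l → (mat i l * X l) * GXG l j) + sum (λ l → (mat i l * X l) * (Z l * mat l j))
        ≈⟨ +-cong (GX[GXG]≈[GXG]XG i j) (sum-cong-≋ (λ l →
             solve 4 (λ g x z h → (g :* x) :* (z :* h) := (z :* g) :* (x :* h))
                     refl (mat i l) (X l) (Z l) (mat l j))) ⟩
      sum (λ l → GXG i l * (X l * mat l j)) + sum (λ l → (Z l * mat i l) * (X l * mat l j))
        ≈⟨ ∑-distrib-+ (λ l → GXG i l * (X l * mat l j))
                       (λ l → (Z l * mat i l) * (X l * mat l j)) ⟨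
      sum (λ l → GXG i l * (X l * mat l j) + (Z l * mat i l) * (X l * mat l j))
        ≈⟨ sum-cong-≋ (λ l → distribʳ (X l * mat l j) _ _) ⟨
      sum (λ l → (GXG i l + Z l * mat i l) * (X l * mat l j))
        ∎

    GXGY+GXT≈YGXG+TXG : ∀ i j → Y j * GXG i j + T j * (X j * mat i j) ≈ Y i * GXG i j + T i * (X i * mat i j)
    GXGY+GXT≈YGXG+TXG i j = begin
      Y j * GXG i j + T j * (X j * mat i j)                   ≈⟨ GX[GXG+ZG]≈GXGY+GXT i j ⟨
      sum (λ l → (mat i l * X l) * (GXG l j + Z l * mat l j)) ≈⟨ GX[GXG+ZG]≈[GXG+GZ]XG i j ⟩
      sum (λ l → (GXG i l + Z l * mat i l) * (X l * mat l j)) ≈⟨ [GXG+GZ]XG≈YGXG+TXG i j ⟩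
      Y i * GXG i j + T i * (X i * mat i j)                   ∎

    det-edge : ∀ {i j} → Edge 𝔽 G i j → det 𝔽 (X , Y , Z , T) i ≈ det 𝔽 (X , Y , Z , T) j
    det-edge {i} {j} gᵢⱼ≉0 =
      edge-equations⇒det≈det gᵢⱼ≉0 (Λ-off-diagonal i≢j) Λⱼᵢ (GXGY+GXT≈YGXG+TXG i j)
      where
      i≢j : i ≢ j
      i≢j ≡.refl = gᵢⱼ≉0 (mat-diag i)
      Λⱼᵢ : GXG i j + Z j * mat i j ≈ Y i * mat i j
      Λⱼᵢ = begin
        GXG i j + Z j * mat i j ≈⟨ +-cong (GXG-sym i j) (*-congˡ (mat-sym i j)) ⟩
        GXG j i + Z j * mat j i ≈⟨ Λ-off-diagonal (≢-sym i≢j) ⟩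
        Y i * mat j i           ≈⟨ *-congˡ (mat-sym j i) ⟩
        Y i * mat i j           ∎

    det-walk : ∀ {i j} → Star (Edge 𝔽 G) i j → det 𝔽 (X , Y , Z , T) i ≈ det 𝔽 (X , Y , Z , T) j
    det-walk = fold (λ i j → det 𝔽 (X , Y , Z , T) i ≈ det 𝔽 (X , Y , Z , T) j) (trans ∘ det-edge) refl

mainTheorem9 : (F : FiniteField) → IsOddPrimePower (FiniteField.order F) →
    (n : ℕ) → n ≥ 3 → (G : LabeledGraph F n) → Connected F G →
    (φ : Vec F n × Vec F n × Vec F n × Vec F n) → InΛ F G φ →
    ∃ λ α → _≋_ F (det F φ) (_·_ F α (I F))
mainTheorem9 F _ (suc _) _ G connected φ@(X , Y , Z , T) φ∈Λ =
  det F φ zero , λ k → trans (sym (det-walk F G X Y Z T φ∈Λ (connected zero k))) (sym (*-identityʳ _))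
  where open FiniteField F using (trans; sym; *-identityʳ)
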